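{- Let $A$ be a set and $\mathcal P A$ its powerset, regarded as a complete orthomodular lattice (complete Boolean algebra with complement $Z\mapsto A\setminus Z$), and let $i\colon A\to\mathcal P A$, $i(a)=\{a\}$. Then $\mathcal P A$ is a free object on $A$ in $\mathbf{SupOMLatLin}$: for every complete orthomodular lattice $Y$ and every function $g\colon A\to Y$ there is a unique linear map $f\colon\mathcal P A\to Y$ with $f\circ i=g$ (namely $f(Z)=\bigvee\{g(a)\colon a\in Z\}$, with adjoint $f^{*}(y)=\{a\in A\colon g(a)\not\perp y\}$).
   Context: An orthomodular lattice is a lattice with $0,1$ and an involutive, order-reversing orthocomplement $x\mapsto x^\perp$ with $x\wedge x^\perp=0$, satisfying $x\le y\Rightarrow y=x\vee(x^\perp\wedge y)$; complete means all joins exist. $x\perp y$ means $x\le y^\perp$. $\mathbf{SupOMLatLin}$ has complete orthomodular lattices as objects and linear maps as morphisms: $f\colon X\to Y$ is linear if there is $f^{*}\colon Y\to X$ with $f(x)\perp y$ iff $x\perp f^{*}(y)$ for all $x\in X,y\in Y$. A free object on a set $A$ is an object $F$ with a function $i\colon A\to F$ such that every function from $A$ to the underlying set of an object $Y$ factors uniquely through $i$ via a morphism $F\to Y$. -}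

module Defs where

open import Level using (Level; _⊔_; Lift; lift) renaming (suc to lsuc)
open import Data.Bool using (Bool; true; false)
open import Data.Empty using (⊥; ⊥-elim)
open import Data.Product using (Σ; _×_; _,_; proj₁; proj₂)
open import Relation.Nullary using (¬_; yes; no)
open import Relation.Binary.PropositionalEquality using (_≡_)
open import Axiom.ExcludedMiddle using (ExcludedMiddle)

-- Equality of elements is the setoid
-- equality  x ≈ y  :=  x ≤ y × y ≤ x  (antisymmetry built in).
pick : ∀ {ι c} {C : Set c} → C → C → Lift ι Bool → C
pick x y (lift true)  = x
pick x y (lift false) = y

record CompleteOML (c r ι : Level) : Set (lsuc (c ⊔ r ⊔ ι)) where
  infix 4 _≤_ _≈_ _⟂_
  infixr 7 _∧_
  infixr 6 _∨_
  field
    Carrier  : Set c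
    _≤_      : Carrier → Carrier → Set r
    ≤-refl   : ∀ {x} → x ≤ x
    ≤-trans  : ∀ {x y z} → x ≤ y → y ≤ z → x ≤ z
    ⋁        : {I : Set ι} → (I → Carrier) → Carrier
    ⋁-upper  : ∀ {I : Set ι} (f : I → Carrier) (i : I) → f i ≤ ⋁ f
    ⋁-least  : ∀ {I : Set ι} (f : I → Carrier) {x} → (∀ i → f i ≤ x) → ⋁ f ≤ x
    _∧_      : Carrier → Carrier → Carrier
    ∧-lower₁ : ∀ {x y} → x ∧ y ≤ x
    ∧-lower₂ : ∀ {x y} → x ∧ y ≤ y
    ∧-greatest : ∀ {x y z} → z ≤ x → z ≤ y → z ≤ x ∧ y
    _ᗮ       : Carrier → Carrier

  _≈_ : Carrier → Carrier → Set r
  x ≈ y = (x ≤ y) × (y ≤ x)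

  𝟘 : Carrier
  𝟘 = ⋁ {Lift ι ⊥} (λ ())

  𝟙 : Carrier
  𝟙 = 𝟘 ᗮ

  _∨_ : Carrier → Carrier → Carrier
  x ∨ y = ⋁ {Lift ι Bool} (pick x y)

  _⟂_ : Carrier → Carrier → Set r
  x ⟂ y = x ≤ (y ᗮ)

  field
    ᗮ-antitone   : ∀ {x y} → x ≤ y → (y ᗮ) ≤ (x ᗮ)
    ᗮ-involutive : ∀ {x} → ((x ᗮ) ᗮ) ≈ x
    ᗮ-compl      : ∀ {x} → (x ∧ (x ᗮ)) ≈ 𝟘
    orthomodular : ∀ {x y} → x ≤ y → y ≈ (x ∨ ((x ᗮ) ∧ y))

open CompleteOML public

module _ {c₁ r₁ ι₁ c₂ r₂ ι₂ : Level}
         (X : CompleteOML c₁ r₁ ι₁) (Y : CompleteOML c₂ r₂ ι₂) where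
  private
    module X = CompleteOML X
    module Y = CompleteOML Y

  IsAdjoint : (Carrier X → Carrier Y) → (Carrier Y → Carrier X) → Set (c₁ ⊔ c₂ ⊔ r₁ ⊔ r₂)
  IsAdjoint f f* = ∀ x y → ((f x Y.⟂ y) → (x X.⟂ f* y)) × ((x X.⟂ f* y) → (f x Y.⟂ y))

  IsLinear : (Carrier X → Carrier Y) → Set (c₁ ⊔ c₂ ⊔ r₁ ⊔ r₂)
  IsLinear f = Σ (Carrier Y → Carrier X) (IsAdjoint f)

IsFreeObject : ∀ {a cF rF ιF} (c r ι : Level) {A : Set a} (F : CompleteOML cF rF ιF)
               (i : A → Carrier F) → Set (lsuc (c ⊔ r ⊔ ι) ⊔ a ⊔ cF ⊔ rF)
IsFreeObject c r ι {A} F i =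
  (Y : CompleteOML c r ι) (g : A → Carrier Y) →
  Σ (Carrier F → Carrier Y) λ f →
    IsLinear F Y f
    × (∀ a → _≈_ Y (f (i a)) (g a))
    × (∀ (f′ : Carrier F → Carrier Y) → IsLinear F Y f′ →
         (∀ a → _≈_ Y (f′ (i a)) (g a)) → ∀ z → _≈_ Y (f′ z) (f z))

-- The powerset of A : Set ℓ, subsets as predicates A → Set ℓ, ordered by
-- inclusion, complement Z ↦ A ∖ Z.  Classical logic (excluded middle) is
-- needed for it to be orthomodular.
module _ {ℓ : Level} (lem : ExcludedMiddle ℓ) (A : Set ℓ) where

  PowersetOML : CompleteOML (lsuc ℓ) ℓ ℓ
  PowersetOML = record
    { Carrier = A → Set ℓ
    ; _≤_ = λ Z W → ∀ {a} → Z a → W a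
    ; ≤-refl = λ z → z
    ; ≤-trans = λ p q z → q (p z)
    ; ⋁ = λ {I} f a → Σ I (λ i → f i a)
    ; ⋁-upper = λ f i z → i , z
    ; ⋁-least = λ f h (i , z) → h i z
    ; _∧_ = λ Z W a → Z a × W a
    ; ∧-lower₁ = proj₁
    ; ∧-lower₂ = proj₂
    ; ∧-greatest = λ p q z → p z , q z
    ; _ᗮ = λ Z a → ¬ Z a
    ; ᗮ-antitone = λ p nw z → nw (p z)
    ; ᗮ-involutive = λ {Z} → (λ {a} nnz → dne Z a nnz) , (λ z nz → nz z)
    ; ᗮ-compl = (λ { (z , nz) → ⊥-elim (nz z) }) , (λ { (lift () , _) })
    ; orthomodular = λ {X} {Y} p →
        (λ {a} y → om X a y) ,
        (λ { (lift true , x) → p x ; (lift false , (_ , y)) → y })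
    }
    where
      dne : (Z : A → Set ℓ) (a : A) → ¬ ¬ Z a → Z a
      dne Z a nnz with lem {Z a}
      ... | yes z = z
      ... | no nz = ⊥-elim (nnz nz)
      om : (X : A → Set ℓ) {Y : A → Set ℓ} (a : A) → Y a →
           Σ (Lift ℓ Bool) (λ i → pick X (λ b → ¬ X b × Y b) i a)
      om X a y with lem {X a}
      ... | yes x = lift true , x
      ... | no nx = lift false , (nx , y)

  singleton : A → A → Set ℓ
  singleton a b = a ≡ b

  module _ {c : Level} (Y : CompleteOML c ℓ ℓ) (g : A → Carrier Y) where
    freeMap : (A → Set ℓ) → Carrier Y
    freeMap Z = ⋁ Y {Σ A Z} (λ p → g (proj₁ p))

    freeAdjoint : Carrier Y → (A → Set ℓ)
    freeAdjoint y a = ¬ (_⟂_ Y (g a) y)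

-- A linear map f with adjoint f* satisfies  f x ≤ w ⟺ x ⟂ f* (wᗮ),  so it
-- preserves all joins.  Every subset is the join of its singletons, hence a
-- linear map out of the powerset is determined by its values on singletons;
-- this gives uniqueness.  The map Z ↦ ⋁_{a ∈ Z} g a is linear with adjoint
-- y ↦ {a : ¬ (g a ⟂ y)}, the only classical step being ¬¬(g a ⟂ y) → g a ⟂ y.
module Submission where

open import Defs
open import Level using (Level)
open import Function using (_∘_)
open import Data.Product using (Σ; _×_; _,_; proj₁; proj₂)
open import Relation.Nullary.Decidable using (decidable-stable)
open import Relation.Binary.PropositionalEquality using (refl)
open import Axiom.ExcludedMiddle using (ExcludedMiddle)

module OMLProperties {c r ι : Level} (X : CompleteOML c r ι) where
  private
    module X = CompleteOML X

  ≈-trans : ∀ {x y z} → x X.≈ y → y X.≈ z → x X.≈ z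
  ≈-trans (p , q) (p′ , q′) = X.≤-trans p p′ , X.≤-trans q′ q

  ≤⇒⟂ᗮ : ∀ {x w} → x X.≤ w → x X.⟂ (w X.ᗮ)
  ≤⇒⟂ᗮ p = X.≤-trans p (proj₂ X.ᗮ-involutive)

  ⟂ᗮ⇒≤ : ∀ {x w} → x X.⟂ (w X.ᗮ) → x X.≤ w
  ⟂ᗮ⇒≤ p = X.≤-trans p (proj₁ X.ᗮ-involutive)

  ⋁-cong : ∀ {I : Set ι} {h k : I → X.Carrier} →
           (∀ i → h i X.≈ k i) → X.⋁ h X.≈ X.⋁ k
  ⋁-cong {h = h} {k} h≈k =
      X.⋁-least h (λ i → X.≤-trans (proj₁ (h≈k i)) (X.⋁-upper k i))
    , X.⋁-least k (λ i → X.≤-trans (proj₂ (h≈k i)) (X.⋁-upper h i))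

module LinearMap {c₁ r₁ c₂ r₂ ι : Level}
                 (X : CompleteOML c₁ r₁ ι) (Y : CompleteOML c₂ r₂ ι)
                 {f : Carrier X → Carrier Y} (linear : IsLinear X Y f) where
  private
    module X = CompleteOML X
    module Y = CompleteOML Y
    open OMLProperties Y
    f* = proj₁ linear
    adjoint = proj₂ linear

  ≤⇒⟂adjoint : ∀ {x w} → f x Y.≤ w → x X.⟂ f* (w Y.ᗮ)
  ≤⇒⟂adjoint {x} {w} p = proj₁ (adjoint x (w Y.ᗮ)) (≤⇒⟂ᗮ p)

  ⟂adjoint⇒≤ : ∀ {x w} → x X.⟂ f* (w Y.ᗮ) → f x Y.≤ w
  ⟂adjoint⇒≤ {x} {w} p = ⟂ᗮ⇒≤ (proj₂ (adjoint x (w Y.ᗮ)) p)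

  monotone : ∀ {x y} → x X.≤ y → f x Y.≤ f y
  monotone x≤y = ⟂adjoint⇒≤ (X.≤-trans x≤y (≤⇒⟂adjoint Y.≤-refl))

  cong : ∀ {x y} → x X.≈ y → f x Y.≈ f y
  cong (p , q) = monotone p , monotone q

  preserves-⋁ : ∀ {I : Set ι} (h : I → Carrier X) → f (X.⋁ h) Y.≈ Y.⋁ (f ∘ h)
  preserves-⋁ h =
      ⟂adjoint⇒≤ (X.⋁-least h (λ i → ≤⇒⟂adjoint (Y.⋁-upper (f ∘ h) i)))
    , Y.⋁-least (f ∘ h) (λ i → monotone (X.⋁-upper h i))

module Powerset {ℓ : Level} (lem : ExcludedMiddle ℓ) (A : Set ℓ) where
  P = PowersetOML lem A
  private
    module P = CompleteOML P

  ≈-⋁-singleton : (Z : A → Set ℓ) → Z P.≈ P.⋁ {Σ A Z} (singleton lem A ∘ proj₁)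
  ≈-⋁-singleton Z = (λ {a} z → (a , z) , refl) , λ { ((_ , z) , refl) → z }

  module _ {c : Level} (Y : CompleteOML c ℓ ℓ) (g : A → Carrier Y) where
    private
      module Y = CompleteOML Y
      open OMLProperties Y
      f = freeMap lem A Y g
      f* = freeAdjoint lem A Y g

    freeMap-adjoint : IsAdjoint P Y f f*
    freeMap-adjoint Z y =
        (λ f⟂y {a} z g⟂̸y → g⟂̸y (Y.≤-trans (Y.⋁-upper (g ∘ proj₁) (a , z)) f⟂y))
      , (λ Z⊆f*y → Y.⋁-least (g ∘ proj₁)
           (λ { (a , z) → decidable-stable lem (Z⊆f*y z) }))

    freeMap-singleton : ∀ a → f (singleton lem A a) Y.≈ g a
    freeMap-singleton a = Y.⋁-least (g ∘ proj₁) (λ { (_ , refl) → Y.≤-refl })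
                        , Y.⋁-upper (g ∘ proj₁) (a , refl)

    linear-unique : (f′ : (A → Set ℓ) → Carrier Y) → IsLinear P Y f′ →
                    (∀ a → f′ (singleton lem A a) Y.≈ g a) → ∀ Z → f′ Z Y.≈ f Z
    linear-unique f′ linear f′i≈g Z =
      ≈-trans (cong (≈-⋁-singleton Z))
        (≈-trans (preserves-⋁ (singleton lem A ∘ proj₁))
                 (⋁-cong (f′i≈g ∘ proj₁)))
      where open LinearMap P Y linear

proposition18 : {ℓ c : Level} (lem : ExcludedMiddle ℓ) (A : Set ℓ) →
    IsFreeObject c ℓ ℓ (PowersetOML lem A) (singleton lem A)
    × ((Y : CompleteOML c ℓ ℓ) (g : A → Carrier Y) →
    IsAdjoint (PowersetOML lem A) Y (freeMap lem A Y g) (freeAdjoint lem A Y g)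
    × (∀ a → _≈_ Y (freeMap lem A Y g (singleton lem A a)) (g a)))
proposition18 lem A =
    (λ Y g → freeMap lem A Y g
           , (freeAdjoint lem A Y g , freeMap-adjoint Y g)
           , freeMap-singleton Y g
           , linear-unique Y g)
  , (λ Y g → freeMap-adjoint Y g , freeMap-singleton Y g)
  where open Powerset lem A
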